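{- Let $m\ge 2$, $n\ge1$ and let $C$ be an $m\times n$ maximal configuration resistant to predators. Then the number of occupied lots in row $m-1$ of $C$ is at most $2\lceil n/3\rceil$.
   Context: An $m\times n$ configuration is a $0$-$1$ matrix $C=(C_{i,j})$, $1\le i\le m$, $1\le j\le n$; row $1$ is the northernmost and row $m$ the southernmost, column $1$ the westernmost and column $n$ the easternmost; $C_{i,j}=1$ means lot $(i,j)$ is occupied by a house. A house at $(i,j)$ is blocked if $j>1$ and $C_{i,j-1}=1$, and $j<n$ and $C_{i,j+1}=1$, and $i<m$ and $C_{i+1,j}=1$ (lots on the western, eastern and southern boundary receive sunlight from outside). $C$ is permissible if no house is blocked; it is maximal if it is permissible and occupying any single empty lot yields a non-permissible configuration. A maximal configuration is resistant to predators if for every empty lot $(i,j)$, after setting $C_{i,j}=1$ the new house at $(i,j)$ is blocked. -}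

module Defs where

open import Data.Nat using (ℕ; zero; suc; _+_; _<_; _≤_)
open import Data.Bool using (Bool; true; false)
open import Data.Fin using (Fin; toℕ)
open import Data.List using (List; length; filter)
open import Data.Fin.Properties using () renaming (_≟_ to _≟ᶠ_)
open import Data.Product using (_×_; Σ; ∃; _,_)
open import Data.Sum using (_⊎_)
open import Relation.Nullary using (¬_)
open import Relation.Binary.PropositionalEquality using (_≡_; _≢_)
open import Data.Bool.Properties using () renaming (_≟_ to _≟ᵇ_)
open import Data.List using (allFin)

-- An m × n configuration. Indices are 0-based: row index 0 is the
-- northernmost row (row 1 in the paper), row index m-1 the southernmost;
-- column index 0 is the westernmost.
Config : ℕ → ℕ → Set
Config m n = Fin m → Fin n → Bool

Blocked : ∀ {m n} → Config m n → Fin m → Fin n → Set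
Blocked {m} {n} C i j =
  (∃ λ (j' : Fin n) → suc (toℕ j') ≡ toℕ j × C i j' ≡ true) ×
  (∃ λ (j' : Fin n) → toℕ j' ≡ suc (toℕ j) × C i j' ≡ true) ×
  (∃ λ (i' : Fin m) → toℕ i' ≡ suc (toℕ i) × C i' j ≡ true)

occupy : ∀ {m n} → Config m n → Fin m → Fin n → Config m n
occupy C i j i' j' with i' ≟ᶠ i | j' ≟ᶠ j
... | Relation.Nullary.yes _ | Relation.Nullary.yes _ = true
... | _ | _ = C i' j'

Permissible : ∀ {m n} → Config m n → Set
Permissible C = ∀ i j → C i j ≡ true → ¬ Blocked C i j

Maximal : ∀ {m n} → Config m n → Set
Maximal C = Permissible C ×
  (∀ i j → C i j ≡ false → ¬ Permissible (occupy C i j))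

ResistantToPredators : ∀ {m n} → Config m n → Set
ResistantToPredators C = Maximal C ×
  (∀ i j → C i j ≡ false → Blocked (occupy C i j) i j)

rowCount : ∀ {m n} → Config m n → Fin m → ℕ
rowCount {n = n} C i = length (filter (λ j → C i j ≟ᵇ true) (allFin n))

{-# OPTIONS --safe #-}
module Submission where

-- Every empty lot of a resistant configuration must become blocked when occupied, so it has
-- a southern neighbour; hence the southernmost row is completely occupied. A house in the
-- row above it therefore already has its southern neighbour, so no three consecutive lots
-- of that row are occupied (the middle house would be blocked). Among any three
-- consecutive lots at most two are occupied, which gives at most 2⌈n/3⌉ houses.

open import Defs
open import Data.Nat using (ℕ; zero; suc; _+_; _*_; _≤_; _<_; _/_; z≤n; s≤s)
open import Data.Nat.Properties
  using (≤-refl; ≤-reflexive; ≤-trans; n≤1+n; m≤n+m; +-comm; +-monoʳ-≤; *-distribˡ-+; <-irrefl; module ≤-Reasoning)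
open import Data.Nat.DivMod using (m/n≡1+[m∸n]/n)
open import Data.Fin using (Fin; zero; suc; toℕ; fromℕ<)
open import Data.Fin.Properties using (toℕ<n; toℕ-fromℕ<)
open import Data.Bool using (Bool; true; false)
open import Data.Bool.Properties using () renaming (_≟_ to _≟ᵇ_)
open import Data.List using (length; filter; tabulate)
open import Data.Product using (∃; _,_; proj₁)
open import Data.Empty using (⊥; ⊥-elim)
open import Function using (_∘_; id)
open import Relation.Binary.PropositionalEquality using (_≡_; refl; sym; trans; cong)

bitValue : Bool → ℕ
bitValue true  = 1
bitValue false = 0

trueCount : ∀ {n} → (Fin n → Bool) → ℕ
trueCount {zero}  g = 0
trueCount {suc n} g = bitValue (g zero) + trueCount (g ∘ suc)

length-filter-tabulate : ∀ {k n} (g : Fin k → Bool) (f : Fin n → Fin k) →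
  length (filter (λ j → g j ≟ᵇ true) (tabulate f)) ≡ trueCount (g ∘ f)
length-filter-tabulate {n = zero}  g f = refl
length-filter-tabulate {n = suc n} g f with g (f zero)
... | true  = cong suc (length-filter-tabulate g (f ∘ suc))
... | false = length-filter-tabulate g (f ∘ suc)

rowCount≡trueCount : ∀ {m n} (C : Config m n) (i : Fin m) → rowCount C i ≡ trueCount (C i)
rowCount≡trueCount C i = length-filter-tabulate (C i) id

trueCount≤length : ∀ {n} (g : Fin n → Bool) → trueCount g ≤ n
trueCount≤length {zero}  g = z≤n
trueCount≤length {suc n} g with g zero
... | true  = s≤s (trueCount≤length (g ∘ suc))
... | false = ≤-trans (trueCount≤length (g ∘ suc)) (n≤1+n n)

NoThreeInARow : ∀ {n} → (Fin n → Bool) → Set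
NoThreeInARow {n} g = (a b c : Fin n) → suc (toℕ a) ≡ toℕ b → suc (toℕ b) ≡ toℕ c →
  g a ≡ true → g b ≡ true → g c ≡ true → ⊥

NoThreeInARow-tail : ∀ {n} {g : Fin (suc n) → Bool} → NoThreeInARow g → NoThreeInARow (g ∘ suc)
NoThreeInARow-tail noThree a b c a+1≡b b+1≡c =
  noThree (suc a) (suc b) (suc c) (cong suc a+1≡b) (cong suc b+1≡c)

threeBits≤2 : ∀ x y z k → (x ≡ true → y ≡ true → z ≡ true → ⊥) →
  bitValue x + (bitValue y + (bitValue z + k)) ≤ 2 + k
threeBits≤2 true  true  true  k notAll = ⊥-elim (notAll refl refl refl)
threeBits≤2 true  true  false k _ = ≤-refl
threeBits≤2 true  false true  k _ = ≤-refl
threeBits≤2 false true  true  k _ = ≤-refl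
threeBits≤2 true  false false k _ = n≤1+n (suc k)
threeBits≤2 false true  false k _ = n≤1+n (suc k)
threeBits≤2 false false true  k _ = n≤1+n (suc k)
threeBits≤2 false false false k _ = m≤n+m k 2

trueCount-NoThreeInARow : ∀ {n} (g : Fin n → Bool) → NoThreeInARow g →
  trueCount g ≤ 2 * ((n + 2) / 3)
trueCount-NoThreeInARow {0} g _ = z≤n
trueCount-NoThreeInARow {1} g _ = ≤-trans (trueCount≤length g) (s≤s z≤n)
trueCount-NoThreeInARow {2} g _ = trueCount≤length g
trueCount-NoThreeInARow {suc (suc (suc n))} g noThree = begin
  trueCount g                          ≤⟨ threeBits≤2 (g zero) (g (suc zero)) (g (suc (suc zero))) _
                                            (noThree zero (suc zero) (suc (suc zero)) refl refl) ⟩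
  2 + trueCount rest                   ≤⟨ +-monoʳ-≤ 2 (trueCount-NoThreeInARow rest restNoThree) ⟩
  2 + 2 * ((n + 2) / 3)                ≡⟨ *-distribˡ-+ 2 1 ((n + 2) / 3) ⟨
  2 * (1 + (n + 2) / 3)                ≡⟨ cong (2 *_) (m/n≡1+[m∸n]/n {3 + n + 2} (s≤s (s≤s (s≤s z≤n)))) ⟨
  2 * ((3 + n + 2) / 3)                ∎
  where
  open ≤-Reasoning
  rest : Fin n → Bool
  rest j = g (suc (suc (suc j)))
  restNoThree : NoThreeInARow rest
  restNoThree = NoThreeInARow-tail (NoThreeInARow-tail (NoThreeInARow-tail noThree))

empty⇒hasSouthernNeighbour : ∀ {m n} {C : Config m n} → ResistantToPredators C →
  ∀ i j → C i j ≡ false → ∃ λ (i' : Fin m) → suc (toℕ i) ≡ toℕ i'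
empty⇒hasSouthernNeighbour (_ , resistant) i j empty with resistant i j empty
... | _ , _ , i' , i'≡i+1 , _ = i' , sym i'≡i+1

southernmostRow-full : ∀ {m n} {C : Config m n} → ResistantToPredators C →
  (s : Fin m) → suc (toℕ s) ≡ m → ∀ j → C s j ≡ true
southernmostRow-full {C = C} resistant s s+1≡m j with C s j in lot
... | true  = refl
... | false with empty⇒hasSouthernNeighbour resistant s j lot
... | i' , s+1≡i' = ⊥-elim (<-irrefl (trans (sym s+1≡i') s+1≡m) (toℕ<n i'))

NoThreeInARow-aboveFullRow : ∀ {m n} {C : Config m n} → Permissible C →
  (i s : Fin m) → toℕ s ≡ suc (toℕ i) → (∀ j → C s j ≡ true) → NoThreeInARow (C i)
NoThreeInARow-aboveFullRow permissible i s s≡i+1 full a b c a+1≡b b+1≡c lotA lotB lotC =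
  permissible i b lotB ((a , a+1≡b , lotA) , (c , sym b+1≡c , lotC) , (s , s≡i+1 , full b))

lemma5p1 : (m n : ℕ) → 2 ≤ m → 1 ≤ n → (C : Config m n) →
    ResistantToPredators C →
    (r : Fin m) → toℕ r + 2 ≡ m →
    rowCount C r ≤ 2 * ((n + 2) / 3)
lemma5p1 m n _ _ C resistant r r+2≡m = begin
  rowCount C r      ≡⟨ rowCount≡trueCount C r ⟩
  trueCount (C r)   ≤⟨ trueCount-NoThreeInARow (C r) noThree ⟩
  2 * ((n + 2) / 3) ∎
  where
  open ≤-Reasoning
  2+r≡m : suc (suc (toℕ r)) ≡ m
  2+r≡m = trans (+-comm 2 (toℕ r)) r+2≡m
  r+1<m : suc (toℕ r) < m
  r+1<m = ≤-reflexive 2+r≡m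
  s : Fin m
  s = fromℕ< r+1<m
  s≡r+1 : toℕ s ≡ suc (toℕ r)
  s≡r+1 = toℕ-fromℕ< r+1<m
  sRowFull : ∀ j → C s j ≡ true
  sRowFull = southernmostRow-full resistant s (trans (cong suc s≡r+1) 2+r≡m)
  noThree : NoThreeInARow (C r)
  noThree = NoThreeInARow-aboveFullRow (proj₁ (proj₁ resistant)) r s s≡r+1 sRowFull
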